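{- Let $(G,\sigma)$ be a signed simple graph with a unique Sachs subgraph. If $G$ has a perfect matching $M$, then $\det(\mathbb A)=(-1)^{|M|}$, where $\mathbb A$ is the adjacency matrix of $(G,\sigma)$.
   Context: A signed graph $(G,\sigma)$ is a graph $G$ with a weight function $\sigma:E(G)\to\{ -1,+1\}$; its adjacency matrix $\mathbb A$ has $(\mathbb A)_{ij}=\sigma(ij)$ if $ij\in E(G)$ and $0$ otherwise. A simple graph has no loops and no multiple edges. A Sachs subgraph of $G$ is a spanning subgraph each of whose components is either a $K_2$, a cycle of length at least $3$, or a vertex with a loop. -}

module Defs where

open import Data.Nat as ℕ using (ℕ; zero; suc; _<ᵇ_)
open import Data.Integer as ℤ using (ℤ; 0ℤ; 1ℤ; -1ℤ)
open import Data.Fin using (Fin; zero; suc; toℕ; punchIn)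
open import Data.Bool using (Bool; true; false; if_then_else_; _∧_)
open import Data.Sign using (Sign)
open import Data.Product using (Σ; ∃; _×_; _,_)
open import Data.Sum using (_⊎_)
open import Relation.Nullary using (¬_)
open import Relation.Binary.PropositionalEquality using (_≡_)
open import Relation.Binary.Construct.Closure.ReflexiveTransitive using (Star)

∑ℕ : ∀ {n} → (Fin n → ℕ) → ℕ
∑ℕ {zero}  f = 0
∑ℕ {suc n} f = f zero ℕ.+ ∑ℕ (λ i → f (suc i))

∑ℤ : ∀ {n} → (Fin n → ℤ) → ℤ
∑ℤ {zero}  f = 0ℤ
∑ℤ {suc n} f = f zero ℤ.+ ∑ℤ (λ i → f (suc i))

Matrix : ℕ → Set
Matrix n = Fin n → Fin n → ℤ

det : ∀ {n} → Matrix n → ℤ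
det {zero}  A = 1ℤ
det {suc n} A =
  ∑ℤ (λ i → (-1ℤ ℤ.^ toℕ i) ℤ.* (A i zero ℤ.* det (λ r c → A (punchIn i r) (suc c))))

record SimpleGraph (n : ℕ) : Set where
  field
    adj    : Fin n → Fin n → Bool
    sym    : ∀ i j → adj i j ≡ adj j i
    irrefl : ∀ i → adj i i ≡ false

-- A signed simple graph (G, σ); σ is given as a symmetric function on
-- vertex pairs, only its values on edges matter.
record SignedGraph (n : ℕ) : Set where
  field
    graph : SimpleGraph n
    σ     : Fin n → Fin n → Sign
    σ-sym : ∀ i j → σ i j ≡ σ j i
  open SimpleGraph graph public

signℤ : Sign → ℤ
signℤ Sign.+ = 1ℤ
signℤ Sign.- = -1ℤ

adjMatrix : ∀ {n} → SignedGraph n → Matrix n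
adjMatrix Gσ i j = if SignedGraph.adj Gσ i j then signℤ (SignedGraph.σ Gσ i j) else 0ℤ

EdgeSet : ℕ → Set
EdgeSet n = Fin n → Fin n → Bool

record IsSpanningSubgraph {n} (G : SimpleGraph n) (H : EdgeSet n) : Set where
  field
    sym : ∀ i j → H i j ≡ H j i
    sub : ∀ i j → H i j ≡ true → SimpleGraph.adj G i j ≡ true

degree : ∀ {n} → EdgeSet n → Fin n → ℕ
degree H v = ∑ℕ (λ w → if H v w then 1 else 0)

edgeCount : ∀ {n} → EdgeSet n → ℕ
edgeCount H = ∑ℕ (λ i → ∑ℕ (λ j → if H i j ∧ (toℕ i <ᵇ toℕ j) then 1 else 0))

Reach : ∀ {n} → EdgeSet n → Fin n → Fin n → Set
Reach H = Star (λ i j → H i j ≡ true)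

ComponentIsK2 : ∀ {n} → EdgeSet n → Fin n → Set
ComponentIsK2 H v =
  Σ _ λ u → ¬ (u ≡ v) × H v u ≡ true × (∀ w → Reach H v w → w ≡ v ⊎ w ≡ u)

-- the component of H containing v is a cycle of length ≥ 3
-- (a connected 2-regular graph with at least 3 vertices)
ComponentIsCycle : ∀ {n} → EdgeSet n → Fin n → Set
ComponentIsCycle H v =
  (∀ w → Reach H v w → degree H w ≡ 2) ×
  (Σ _ λ a → Σ _ λ b → Σ _ λ c →
     Reach H v a × Reach H v b × Reach H v c ×
     ¬ (a ≡ b) × ¬ (a ≡ c) × ¬ (b ≡ c))

-- Sachs subgraph: spanning subgraph each of whose components is a K₂
-- or a cycle of length ≥ 3 (no loops occur since G is simple).
record IsSachs {n} (G : SimpleGraph n) (H : EdgeSet n) : Set where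
  field
    spanning   : IsSpanningSubgraph G H
    components : ∀ v → ComponentIsK2 H v ⊎ ComponentIsCycle H v

HasUniqueSachs : ∀ {n} → SimpleGraph n → Set
HasUniqueSachs {n} G =
  Σ (EdgeSet n) λ H → IsSachs G H × (∀ H' → IsSachs G H' → ∀ i j → H' i j ≡ H i j)

record IsPerfectMatching {n} (G : SimpleGraph n) (M : EdgeSet n) : Set where
  field
    spanning : IsSpanningSubgraph G M
    deg1     : ∀ v → degree M v ≡ 1

module Submission where

-- Expanding det 𝔸, a permutation g contributes only if each i is adjacent to g i, and then the
-- edges {i, g i} form a Sachs subgraph (2-cycles of g give K₂'s, longer cycles give cycles).
-- The matching M is such a subgraph, coming from the involution p pairing the ends of each
-- edge of M; so by uniqueness p is the only contributing permutation and
-- det 𝔸 = sgn p · ∏ σ(i, p i). Each edge occurs twice in the product, which is therefore 1,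
-- and sgn p = (-1)^|M| since the inversions of p other than its 2-cycles come in pairs.

open import Defs
open import Data.Nat using (ℕ)
open import Data.Integer using (-1ℤ; _^_)
open import Relation.Binary.PropositionalEquality using (_≡_)

open import Algebra.Bundles using (CommutativeMonoid)
import Algebra.Properties.CommutativeMonoid.Sum as CommutativeMonoidSum
open import Data.Bool using (Bool; true; false; not; _∧_; _∨_; if_then_else_)
open import Data.Bool.Properties using (∧-comm; ∧-idem; ∧-zeroʳ; ∧-identityʳ; ∨-comm; not-involutive)
open import Data.Empty using (⊥-elim)
open import Data.Fin using (Fin; zero; suc; toℕ; punchIn; punchOut)
open import Data.Fin.Permutation as Perm using (Permutation′; _⟨$⟩ʳ_; _⟨$⟩ˡ_)
open import Data.Fin.Properties using (_≟_; toℕ-injective; suc-injective; punchInᵢ≢i; punchIn-punchOut)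
open import Data.Integer as ℤ using (ℤ; 0ℤ; 1ℤ)
import Data.Integer.Properties as ℤP
open import Data.Integer.Tactic.RingSolver using (solve-∀)
import Data.Nat as ℕ
import Data.Nat.Properties as ℕP
open import Data.Product using (Σ; _×_; _,_; proj₁; proj₂)
open import Data.Sign using (Sign)
open import Data.Sum using (_⊎_; inj₁; inj₂)
open import Function using (_∘_; flip)
open import Relation.Binary.PropositionalEquality using (refl; sym; trans; cong; cong₂; subst; module ≡-Reasoning)
open import Relation.Nullary using (¬_; yes; no; does)
open import Relation.Nullary.Decidable using (dec-true; dec-false)
open import Relation.Binary.Construct.Closure.ReflexiveTransitive using (ε; _◅_)

open CommutativeMonoidSum ℕP.+-0-commutativeMonoid
  using (sum; sum-remove; sum-cong-≗; ∑-distrib-+; ∑-comm; ∑-permute)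
module ℤ∑ = CommutativeMonoidSum ℤP.+-0-commutativeMonoid
module ℤ∏ = CommutativeMonoidSum ℤP.*-1-commutativeMonoid

[_] : Bool → ℕ
[ b ] = if b then 1 else 0

indicator-split : ∀ x y → [ x ] ≡ [ y ∧ x ] ℕ.+ [ not y ∧ x ]
indicator-split false false = refl
indicator-split false true  = refl
indicator-split true  false = refl
indicator-split true  true  = refl

indicator-∨ : ∀ a b → a ∧ b ≡ false → [ a ∨ b ] ≡ [ a ] ℕ.+ [ b ]
indicator-∨ false b     _ = refl
indicator-∨ true  false _ = refl

module _ {c ℓ} (M : CommutativeMonoid c ℓ) where
  open CommutativeMonoid M using (Carrier; _≈_) renaming (ε to 0#; trans to ≈-trans)
  open CommutativeMonoidSum M using () renaming (sum to ∑; sum-cong-≋ to ∑-cong; sum-replicate-zero to ∑-replicate-ε)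

  sum-zero : ∀ {n} (f : Fin n → Carrier) → (∀ i → f i ≈ 0#) → ∑ f ≈ 0#
  sum-zero {n} _ f≈ε = ≈-trans (∑-cong f≈ε) (∑-replicate-ε n)

∑ℕ≡sum : ∀ {n} (f : Fin n → ℕ) → ∑ℕ f ≡ sum f
∑ℕ≡sum {ℕ.zero}  f = refl
∑ℕ≡sum {ℕ.suc n} f = cong (f zero ℕ.+_) (∑ℕ≡sum (f ∘ suc))

∑ℤ≡sum : ∀ {n} (f : Fin n → ℤ) → ∑ℤ f ≡ ℤ∑.sum f
∑ℤ≡sum {ℕ.zero}  f = refl
∑ℤ≡sum {ℕ.suc n} f = cong (ℤ._+_ (f zero)) (∑ℤ≡sum (f ∘ suc))

sum-select : ∀ {n} {h : Fin n → Bool} {w} → h w ≡ true → (∀ j → h j ≡ true → j ≡ w) →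
             (f : Fin n → Bool) → sum (λ j → [ h j ∧ f j ]) ≡ [ f w ]
sum-select {ℕ.suc n} {h} {w} hw unique f = begin
  sum (λ j → [ h j ∧ f j ])                                  ≡⟨ sum-remove {i = w} (λ j → [ h j ∧ f j ]) ⟩
  [ h w ∧ f w ] ℕ.+ sum (λ r → [ h (punchIn w r) ∧ f (punchIn w r) ])
    ≡⟨ cong₂ ℕ._+_ (cong (λ b → [ b ∧ f w ]) hw) (sum-zero ℕP.+-0-commutativeMonoid _ off-w) ⟩
  [ f w ] ℕ.+ 0                                              ≡⟨ ℕP.+-identityʳ _ ⟩
  [ f w ]                                                    ∎
  where
  open ≡-Reasoning
  off-w : ∀ r → [ h (punchIn w r) ∧ f (punchIn w r) ] ≡ 0
  off-w r with h (punchIn w r) in e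
  ... | true  = ⊥-elim (punchInᵢ≢i w r (unique _ e))
  ... | false = refl

unique⇒indicator-sum≡1 : ∀ {n} {h : Fin n → Bool} {w} → h w ≡ true → (∀ j → h j ≡ true → j ≡ w) →
                         sum (λ j → [ h j ]) ≡ 1
unique⇒indicator-sum≡1 {h = h} hw unique =
  trans (sum-cong-≗ (λ j → cong [_] (sym (∧-identityʳ (h j))))) (sum-select hw unique (λ _ → true))

indicator-sum≡0⇒false : ∀ {n} (h : Fin n → Bool) → sum (λ i → [ h i ]) ≡ 0 → ∀ i → h i ≡ false
indicator-sum≡0⇒false {ℕ.suc n} h s i with h zero in e
indicator-sum≡0⇒false h s zero    | false = e
indicator-sum≡0⇒false h s (suc i) | false = indicator-sum≡0⇒false (h ∘ suc) s i

indicator-sum≡1⇒unique : ∀ {n} (h : Fin n → Bool) → sum (λ i → [ h i ]) ≡ 1 →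
                         Σ (Fin n) λ w → h w ≡ true × (∀ v → h v ≡ true → v ≡ w)
indicator-sum≡1⇒unique {ℕ.suc n} h s with h zero in e
... | true  = zero , e , only-zero
  where
  only-zero : ∀ v → h v ≡ true → v ≡ zero
  only-zero zero    _  = refl
  only-zero (suc v) hv with () ← trans (sym hv) (indicator-sum≡0⇒false (h ∘ suc) (ℕP.suc-injective s) v)
... | false with indicator-sum≡1⇒unique (h ∘ suc) s
...   | w , hw , unique = suc w , hw , only-w
  where
  only-w : ∀ v → h v ≡ true → v ≡ suc w
  only-w zero    hv with () ← trans (sym hv) e
  only-w (suc v) hv = cong suc (unique v hv)

module InvolutionPairing {I : Set} (∑ : (I → ℕ) → ℕ)
  (∑-cong : ∀ {f g} → (∀ x → f x ≡ g x) → ∑ f ≡ ∑ g)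
  (∑-+ : ∀ f g → ∑ (λ x → f x ℕ.+ g x) ≡ ∑ f ℕ.+ ∑ g)
  (τ : I → I) (∑-reindex : ∀ f → ∑ (λ x → f (τ x)) ≡ ∑ f) where

  count-double : (h c : I → Bool) → (∀ x → h (τ x) ≡ h x) → (∀ x → h x ≡ true → c (τ x) ≡ not (c x)) →
                 ∑ (λ x → [ h x ]) ≡ 2 ℕ.* ∑ (λ x → [ c x ∧ h x ])
  count-double h c h∘τ c∘τ = begin
    ∑ (λ x → [ h x ])                                     ≡⟨ ∑-cong (λ x → indicator-split (h x) (c x)) ⟩
    ∑ (λ x → [ c x ∧ h x ] ℕ.+ [ not (c x) ∧ h x ])       ≡⟨ ∑-+ _ _ ⟩
    S ℕ.+ ∑ (λ x → [ not (c x) ∧ h x ])                   ≡⟨ cong (S ℕ.+_) (sym (∑-reindex _)) ⟩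
    S ℕ.+ ∑ (λ x → [ not (c (τ x)) ∧ h (τ x) ])           ≡⟨ cong (S ℕ.+_) (∑-cong τ-swaps) ⟩
    S ℕ.+ S                                               ≡⟨ cong (S ℕ.+_) (sym (ℕP.+-identityʳ S)) ⟩
    2 ℕ.* S                                               ∎
    where
    open ≡-Reasoning
    S = ∑ (λ x → [ c x ∧ h x ])
    τ-swaps : ∀ x → [ not (c (τ x)) ∧ h (τ x) ] ≡ [ c x ∧ h x ]
    τ-swaps x rewrite h∘τ x with h x in hx
    ... | false = cong [_] (trans (∧-zeroʳ _) (sym (∧-zeroʳ _)))
    ... | true  = cong (λ b → [ b ∧ true ]) (trans (cong not (c∘τ x hx)) (not-involutive (c x)))

infix 7 _<ᵇ_
_<ᵇ_ : ∀ {n} → Fin n → Fin n → Bool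
i <ᵇ j = toℕ i ℕ.<ᵇ toℕ j

<ᵇ-punchIn : ∀ {n} (m : Fin (ℕ.suc n)) (a b : Fin n) → punchIn m a <ᵇ punchIn m b ≡ a <ᵇ b
<ᵇ-punchIn zero    a       b       = refl
<ᵇ-punchIn (suc m) zero    zero    = refl
<ᵇ-punchIn (suc m) zero    (suc b) = refl
<ᵇ-punchIn (suc m) (suc a) zero    = refl
<ᵇ-punchIn (suc m) (suc a) (suc b) = <ᵇ-punchIn m a b

ℕ<ᵇ-flip : ∀ x y → ¬ x ≡ y → (y ℕ.<ᵇ x) ≡ not (x ℕ.<ᵇ y)
ℕ<ᵇ-flip ℕ.zero    ℕ.zero    x≢y = ⊥-elim (x≢y refl)
ℕ<ᵇ-flip ℕ.zero    (ℕ.suc y) x≢y = refl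
ℕ<ᵇ-flip (ℕ.suc x) ℕ.zero    x≢y = refl
ℕ<ᵇ-flip (ℕ.suc x) (ℕ.suc y) x≢y = ℕ<ᵇ-flip x y (x≢y ∘ cong ℕ.suc)

<ᵇ-flip : ∀ {n} {i j : Fin n} → ¬ i ≡ j → j <ᵇ i ≡ not (i <ᵇ j)
<ᵇ-flip {i = i} {j} i≢j = ℕ<ᵇ-flip (toℕ i) (toℕ j) (i≢j ∘ toℕ-injective)

count-punchIn-below : ∀ {n} (m : Fin (ℕ.suc n)) → sum (λ r → [ punchIn m r <ᵇ m ]) ≡ toℕ m
count-punchIn-below {n} zero = sum-zero ℕP.+-0-commutativeMonoid {n} _ (λ _ → refl)
count-punchIn-below {ℕ.suc n} (suc m) = cong ℕ.suc (count-punchIn-below m)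

inversions : ∀ {n} → Permutation′ n → ℕ
inversions π = sum λ i → sum λ j → [ i <ᵇ j ∧ (π ⟨$⟩ʳ j) <ᵇ (π ⟨$⟩ʳ i) ]

-- Row m = π⁻¹ 0 forms an inversion with exactly the m rows above it and none below.
inversions-remove : ∀ {n} (π : Permutation′ (ℕ.suc n)) →
  inversions π ≡ toℕ (π ⟨$⟩ˡ zero) ℕ.+ inversions (Perm.remove (π ⟨$⟩ˡ zero) π)
inversions-remove {n} π = begin
  inversions π                                                   ≡⟨ sum-remove {i = m} (sum ∘ B) ⟩
  sum (B m) ℕ.+ sum (λ r → sum (B (punchIn m r)))
    ≡⟨ cong₂ ℕ._+_ (sum-zero ℕP.+-0-commutativeMonoid (B m) row-m) (sum-cong-≗ (λ r → sum-remove {i = m} (B (punchIn m r)))) ⟩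
  0 ℕ.+ sum (λ r → B (punchIn m r) m ℕ.+ sum (λ s → B (punchIn m r) (punchIn m s)))
    ≡⟨ sum-cong-≗ (λ r → cong₂ ℕ._+_ (column-m r) (sum-cong-≗ (rows-of-ρ r))) ⟩
  sum (λ r → [ punchIn m r <ᵇ m ] ℕ.+ sum (λ s → [ r <ᵇ s ∧ (ρ ⟨$⟩ʳ s) <ᵇ (ρ ⟨$⟩ʳ r) ]))
    ≡⟨ ∑-distrib-+ (λ r → [ punchIn m r <ᵇ m ]) (λ r → sum (λ s → [ r <ᵇ s ∧ (ρ ⟨$⟩ʳ s) <ᵇ (ρ ⟨$⟩ʳ r) ])) ⟩
  sum (λ r → [ punchIn m r <ᵇ m ]) ℕ.+ inversions ρ              ≡⟨ cong (ℕ._+ inversions ρ) (count-punchIn-below m) ⟩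
  toℕ m ℕ.+ inversions ρ                                         ∎
  where
  open ≡-Reasoning
  m = π ⟨$⟩ˡ zero
  ρ = Perm.remove m π
  B : Fin (ℕ.suc n) → Fin (ℕ.suc n) → ℕ
  B i j = [ i <ᵇ j ∧ (π ⟨$⟩ʳ j) <ᵇ (π ⟨$⟩ʳ i) ]
  πm≡0 : π ⟨$⟩ʳ m ≡ zero
  πm≡0 = Perm.inverseʳ π
  π∘punchIn : ∀ r → π ⟨$⟩ʳ punchIn m r ≡ suc (ρ ⟨$⟩ʳ r)
  π∘punchIn = Perm.punchIn-permute′ π zero
  row-m : ∀ j → B m j ≡ 0
  row-m j = trans (cong (λ k → [ m <ᵇ j ∧ (π ⟨$⟩ʳ j) <ᵇ k ]) πm≡0) (cong [_] (∧-zeroʳ _))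
  column-m : ∀ r → B (punchIn m r) m ≡ [ punchIn m r <ᵇ m ]
  column-m r = trans (cong₂ (λ k l → [ punchIn m r <ᵇ m ∧ k <ᵇ l ]) πm≡0 (π∘punchIn r)) (cong [_] (∧-identityʳ _))
  rows-of-ρ : ∀ r s → B (punchIn m r) (punchIn m s) ≡ [ r <ᵇ s ∧ (ρ ⟨$⟩ʳ s) <ᵇ (ρ ⟨$⟩ʳ r) ]
  rows-of-ρ r s = cong [_] (cong₂ _∧_ (<ᵇ-punchIn m r s) (cong₂ _<ᵇ_ (π∘punchIn s) (π∘punchIn r)))

⟨$⟩ʳ-injective : ∀ {n} (π : Permutation′ n) {x y} → π ⟨$⟩ʳ x ≡ π ⟨$⟩ʳ y → x ≡ y
⟨$⟩ʳ-injective π {x} {y} πx≡πy = trans (sym (Perm.inverseˡ π)) (trans (cong (π ⟨$⟩ˡ_) πx≡πy) (Perm.inverseˡ π))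

∏ : ∀ {n} → (Fin n → ℤ) → ℤ
∏ = ℤ∏.sum

Supported : ∀ {n} → Matrix n → Permutation′ n → Set
Supported A π = ∀ i → ¬ A i (π ⟨$⟩ʳ i) ≡ 0ℤ

minor : ∀ {n} → Matrix (ℕ.suc n) → Fin (ℕ.suc n) → Matrix n
minor A i r c = A (punchIn i r) (suc c)

laplaceTerm : ∀ {n} → Matrix (ℕ.suc n) → Fin (ℕ.suc n) → ℤ
laplaceTerm A i = -1ℤ ^ toℕ i ℤ.* (A i zero ℤ.* det (minor A i))

laplace-expansion : ∀ {n} (A : Matrix (ℕ.suc n)) → det A ≡ ℤ∑.sum (laplaceTerm A)
laplace-expansion A = ∑ℤ≡sum (laplaceTerm A)

punchIn-cases : ∀ {n} {P : Fin (ℕ.suc n) → Set} i → P i → (∀ k → P (punchIn i k)) → ∀ j → P j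
punchIn-cases {P = P} i Pi Pk j with i ≟ j
... | yes refl = Pi
... | no  i≢j  = subst P (punchIn-punchOut i≢j) (Pk (punchOut i≢j))

insert-at : ∀ {n} i j (π : Permutation′ n) → Perm.insert i j π ⟨$⟩ʳ i ≡ j
insert-at i j π with i ≟ i
... | yes _  = refl
... | no i≢i = ⊥-elim (i≢i refl)

insert-supported : ∀ {n} (A : Matrix (ℕ.suc n)) i g → ¬ A i zero ≡ 0ℤ → Supported (minor A i) g →
                   Supported A (Perm.insert i zero g)
insert-supported A i g Ai0≢0 supp = punchIn-cases i
  (Ai0≢0 ∘ trans (cong (A i) (sym (insert-at i zero g))))
  (λ k → supp k ∘ trans (cong (A (punchIn i k)) (sym (Perm.insert-punchIn i zero g k))))

mutual
  det-unsupported : ∀ {n} (A : Matrix n) → (∀ g → ¬ Supported A g) → det A ≡ 0ℤ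
  det-unsupported {ℕ.zero}  A none = ⊥-elim (none Perm.id λ ())
  det-unsupported {ℕ.suc n} A none = trans (laplace-expansion A)
    (sum-zero ℤP.+-0-commutativeMonoid _ (λ i → laplaceTerm-unsupported A i (λ g → none (Perm.insert i zero g))))

  laplaceTerm-unsupported : ∀ {n} (A : Matrix (ℕ.suc n)) i → (∀ g → ¬ Supported A (Perm.insert i zero g)) →
                            laplaceTerm A i ≡ 0ℤ
  laplaceTerm-unsupported A i none with A i zero ℤ.≟ 0ℤ
  ... | yes Ai0≡0 = trans (cong (λ a → -1ℤ ^ toℕ i ℤ.* (a ℤ.* det (minor A i))) Ai0≡0)
                          (trans (cong (-1ℤ ^ toℕ i ℤ.*_) (ℤP.*-zeroˡ (det (minor A i)))) (ℤP.*-zeroʳ (-1ℤ ^ toℕ i)))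
  ... | no  Ai0≢0 = trans (cong (λ d → -1ℤ ^ toℕ i ℤ.* (A i zero ℤ.* d)) minor-vanishes)
                          (trans (cong (-1ℤ ^ toℕ i ℤ.*_) (ℤP.*-zeroʳ (A i zero))) (ℤP.*-zeroʳ (-1ℤ ^ toℕ i)))
    where
    minor-vanishes : det (minor A i) ≡ 0ℤ
    minor-vanishes = det-unsupported (minor A i) (λ g → none g ∘ insert-supported A i g Ai0≢0)

det-single-term : ∀ {n} (A : Matrix (ℕ.suc n)) m → (∀ r → laplaceTerm A (punchIn m r) ≡ 0ℤ) →
                  det A ≡ laplaceTerm A m
det-single-term A m others-vanish = begin
  det A                                                   ≡⟨ laplace-expansion A ⟩
  ℤ∑.sum (laplaceTerm A)                                  ≡⟨ ℤ∑.sum-remove {i = m} (laplaceTerm A) ⟩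
  laplaceTerm A m ℤ.+ ℤ∑.sum (laplaceTerm A ∘ punchIn m)
    ≡⟨ cong (ℤ._+_ (laplaceTerm A m)) (sum-zero ℤP.+-0-commutativeMonoid _ others-vanish) ⟩
  laplaceTerm A m ℤ.+ 0ℤ                                  ≡⟨ ℤP.+-identityʳ _ ⟩
  laplaceTerm A m                                         ∎
  where open ≡-Reasoning

*-regroup : ∀ a b c d → a ℤ.* (b ℤ.* (c ℤ.* d)) ≡ (a ℤ.* c) ℤ.* (b ℤ.* d)
*-regroup = solve-∀

det-unique-support : ∀ {n} (A : Matrix n) (π : Permutation′ n) → Supported A π →
                     (∀ g → Supported A g → g Perm.≈ π) →
                     det A ≡ -1ℤ ^ inversions π ℤ.* ∏ (λ i → A i (π ⟨$⟩ʳ i))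
det-unique-support {ℕ.zero}  A π supp unique = refl
det-unique-support {ℕ.suc n} A π supp unique = begin
  det A                                                       ≡⟨ det-single-term A m other-rows ⟩
  -1ℤ ^ toℕ m ℤ.* (A m zero ℤ.* det (minor A m))
    ≡⟨ cong (λ d → -1ℤ ^ toℕ m ℤ.* (A m zero ℤ.* d)) (det-unique-support (minor A m) ρ supp-ρ unique-ρ) ⟩
  -1ℤ ^ toℕ m ℤ.* (A m zero ℤ.* (-1ℤ ^ inversions ρ ℤ.* ∏ (λ r → minor A m r (ρ ⟨$⟩ʳ r))))
    ≡⟨ *-regroup (-1ℤ ^ toℕ m) (A m zero) (-1ℤ ^ inversions ρ) (∏ (λ r → minor A m r (ρ ⟨$⟩ʳ r))) ⟩
  (-1ℤ ^ toℕ m ℤ.* -1ℤ ^ inversions ρ) ℤ.* (A m zero ℤ.* ∏ (λ r → minor A m r (ρ ⟨$⟩ʳ r)))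
    ≡⟨ cong₂ ℤ._*_ (sym (ℤP.^-distribˡ-+-* -1ℤ (toℕ m) (inversions ρ)))
                   (cong₂ ℤ._*_ (cong (A m) (sym πm≡0)) (ℤ∏.sum-cong-≗ (λ r → cong (A (punchIn m r)) (sym (π∘punchIn r))))) ⟩
  -1ℤ ^ (toℕ m ℕ.+ inversions ρ) ℤ.* (A m (π ⟨$⟩ʳ m) ℤ.* ∏ (λ r → A (punchIn m r) (π ⟨$⟩ʳ punchIn m r)))
    ≡⟨ cong₂ ℤ._*_ (cong (-1ℤ ^_) (sym (inversions-remove π))) (sym (ℤ∏.sum-remove {i = m} (λ i → A i (π ⟨$⟩ʳ i)))) ⟩
  -1ℤ ^ inversions π ℤ.* ∏ (λ i → A i (π ⟨$⟩ʳ i))            ∎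
  where
  open ≡-Reasoning
  m = π ⟨$⟩ˡ zero
  ρ = Perm.remove m π
  πm≡0 : π ⟨$⟩ʳ m ≡ zero
  πm≡0 = Perm.inverseʳ π
  π∘punchIn : ∀ r → π ⟨$⟩ʳ punchIn m r ≡ suc (ρ ⟨$⟩ʳ r)
  π∘punchIn = Perm.punchIn-permute′ π zero
  supp-ρ : Supported (minor A m) ρ
  supp-ρ r = supp (punchIn m r) ∘ trans (cong (A (punchIn m r)) (π∘punchIn r))
  unique-ρ : ∀ g → Supported (minor A m) g → g Perm.≈ ρ
  unique-ρ g supp-g r = suc-injective (begin
    suc (g ⟨$⟩ʳ r)                                ≡⟨ Perm.insert-punchIn m zero g r ⟨
    Perm.insert m zero g ⟨$⟩ʳ punchIn m r         ≡⟨ unique (Perm.insert m zero g) (insert-supported A m g (supp m ∘ trans (cong (A m) πm≡0)) supp-g) (punchIn m r) ⟩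
    π ⟨$⟩ʳ punchIn m r                            ≡⟨ π∘punchIn r ⟩
    suc (ρ ⟨$⟩ʳ r)                                ∎)
  other-rows : ∀ r → laplaceTerm A (punchIn m r) ≡ 0ℤ
  other-rows r = laplaceTerm-unsupported A (punchIn m r) λ g supp-g →
    punchInᵢ≢i m r (⟨$⟩ʳ-injective π (begin
      π ⟨$⟩ʳ punchIn m r                           ≡⟨ unique (Perm.insert (punchIn m r) zero g) supp-g (punchIn m r) ⟨
      Perm.insert (punchIn m r) zero g ⟨$⟩ʳ punchIn m r ≡⟨ insert-at (punchIn m r) zero g ⟩
      zero                                         ≡⟨ πm≡0 ⟨
      π ⟨$⟩ʳ m                                     ∎))

infix 7 _==_
_==_ : ∀ {n} → Fin n → Fin n → Bool
i == j = does (i ≟ j)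

==⇒≡ : ∀ {n} {i j : Fin n} → i == j ≡ true → i ≡ j
==⇒≡ {i = i} {j} e with i ≟ j
... | yes i≡j = i≡j

==-refl : ∀ {n} (i : Fin n) → i == i ≡ true
==-refl i = dec-true (i ≟ i) refl

==-sym : ∀ {n} (i j : Fin n) → i == j ≡ j == i
==-sym i j with i ≟ j
... | yes i≡j = sym (dec-true (j ≟ i) (sym i≡j))
... | no  i≢j = sym (dec-false (j ≟ i) (i≢j ∘ sym))

reach-preserves : ∀ {n} {H : EdgeSet n} (P : Fin n → Set) → (∀ {x y} → H x y ≡ true → P x → P y) →
                  ∀ {x y} → Reach H x y → P x → P y
reach-preserves P step ε        Px = Px
reach-preserves P step (e ◅ xs) Px = reach-preserves P step xs (step e Px)

adjacent⇒distinct : ∀ {n} (G : SimpleGraph n) {i j} → SimpleGraph.adj G i j ≡ true → ¬ i ≡ j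
adjacent⇒distinct G {i} e refl with () ← trans (sym e) (SimpleGraph.irrefl G i)

module PermutationGraph {n} (g : Permutation′ n) where

  private
    g⟨_⟩ : Fin n → Fin n
    g⟨ i ⟩ = g ⟨$⟩ʳ i

  edges : EdgeSet n
  edges i j = j == g⟨ i ⟩ ∨ i == g⟨ j ⟩

  edge-cases : ∀ {i j} → edges i j ≡ true → j ≡ g⟨ i ⟩ ⊎ i ≡ g⟨ j ⟩
  edge-cases {i} {j} e with j == g⟨ i ⟩ in j≡gi
  ... | true  = inj₁ (==⇒≡ j≡gi)
  ... | false = inj₂ (==⇒≡ e)

  edge-to-image : ∀ i → edges i g⟨ i ⟩ ≡ true
  edge-to-image i = cong (_∨ i == g⟨ g⟨ i ⟩ ⟩) (==-refl g⟨ i ⟩)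

  edges-sym : ∀ i j → edges i j ≡ edges j i
  edges-sym i j = ∨-comm (j == g⟨ i ⟩) (i == g⟨ j ⟩)

  two-cycle-closed : ∀ {v w} → g⟨ g⟨ v ⟩ ⟩ ≡ v → Reach edges v w → w ≡ v ⊎ w ≡ g⟨ v ⟩
  two-cycle-closed {v} ggv≡v r = reach-preserves (λ x → x ≡ v ⊎ x ≡ g⟨ v ⟩) step r (inj₁ refl)
    where
    step : ∀ {x y} → edges x y ≡ true → x ≡ v ⊎ x ≡ g⟨ v ⟩ → y ≡ v ⊎ y ≡ g⟨ v ⟩
    step {y = y} e (inj₁ refl) with edge-cases {v} {y} e
    ... | inj₁ y≡gv = inj₂ y≡gv
    ... | inj₂ v≡gy = inj₂ (⟨$⟩ʳ-injective g (trans (sym v≡gy) (sym ggv≡v)))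
    step {y = y} e (inj₂ refl) with edge-cases {g⟨ v ⟩} {y} e
    ... | inj₁ y≡ggv = inj₁ (trans y≡ggv ggv≡v)
    ... | inj₂ gv≡gy = inj₁ (⟨$⟩ʳ-injective g (sym gv≡gy))

  not-two-cycle-closed : ∀ {v w} → ¬ g⟨ g⟨ v ⟩ ⟩ ≡ v → Reach edges v w → ¬ g⟨ g⟨ w ⟩ ⟩ ≡ w
  not-two-cycle-closed = flip (reach-preserves (λ x → ¬ g⟨ g⟨ x ⟩ ⟩ ≡ x) step)
    where
    step : ∀ {x y} → edges x y ≡ true → ¬ g⟨ g⟨ x ⟩ ⟩ ≡ x → ¬ g⟨ g⟨ y ⟩ ⟩ ≡ y
    step {x} {y} e ggx≢x ggy≡y with edge-cases {x} {y} e
    ... | inj₁ refl = ggx≢x (⟨$⟩ʳ-injective g ggy≡y)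
    ... | inj₂ refl = ggx≢x (cong g⟨_⟩ ggy≡y)

  degree≡2 : ∀ w → ¬ g⟨ g⟨ w ⟩ ⟩ ≡ w → degree edges w ≡ 2
  degree≡2 w ggw≢w = begin
    degree edges w                                               ≡⟨ ∑ℕ≡sum (λ j → [ j == g⟨ w ⟩ ∨ w == g⟨ j ⟩ ]) ⟩
    sum (λ j → [ j == g⟨ w ⟩ ∨ w == g⟨ j ⟩ ])                   ≡⟨ sum-cong-≗ (λ j → indicator-∨ (j == g⟨ w ⟩) (w == g⟨ j ⟩) (disjoint j)) ⟩
    sum (λ j → [ j == g⟨ w ⟩ ] ℕ.+ [ w == g⟨ j ⟩ ])             ≡⟨ ∑-distrib-+ (λ j → [ j == g⟨ w ⟩ ]) (λ j → [ w == g⟨ j ⟩ ]) ⟩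
    sum (λ j → [ j == g⟨ w ⟩ ]) ℕ.+ sum (λ j → [ w == g⟨ j ⟩ ])
      ≡⟨ cong₂ ℕ._+_ (unique⇒indicator-sum≡1 {h = _== g⟨ w ⟩} (==-refl g⟨ w ⟩) (λ _ → ==⇒≡))
                     (unique⇒indicator-sum≡1 {h = λ j → w == g⟨ j ⟩} (trans (cong (w ==_) (Perm.inverseʳ g)) (==-refl w)) preimage-unique) ⟩
    2                                                            ∎
    where
    open ≡-Reasoning
    disjoint : ∀ j → (j == g⟨ w ⟩) ∧ (w == g⟨ j ⟩) ≡ false
    disjoint j with j == g⟨ w ⟩ in j≡gw | w == g⟨ j ⟩ in w≡gj
    ... | true  | true  = ⊥-elim (ggw≢w (trans (cong g⟨_⟩ (sym (==⇒≡ j≡gw))) (sym (==⇒≡ w≡gj))))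
    ... | true  | false = refl
    ... | false | _     = refl
    preimage-unique : ∀ j → w == g⟨ j ⟩ ≡ true → j ≡ g ⟨$⟩ˡ w
    preimage-unique j w≡gj = trans (sym (Perm.inverseˡ g)) (cong (g ⟨$⟩ˡ_) (sym (==⇒≡ w≡gj)))

  components : (∀ i → ¬ g⟨ i ⟩ ≡ i) → ∀ v → ComponentIsK2 edges v ⊎ ComponentIsCycle edges v
  components fixed-point-free v with g⟨ g⟨ v ⟩ ⟩ ≟ v
  ... | yes ggv≡v = inj₁ (g⟨ v ⟩ , fixed-point-free v , edge-to-image v , λ _ → two-cycle-closed ggv≡v)
  ... | no  ggv≢v = inj₂ ( (λ w r → degree≡2 w (not-two-cycle-closed ggv≢v r))
                         , v , g⟨ v ⟩ , g⟨ g⟨ v ⟩ ⟩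
                         , ε , edge-to-image v ◅ ε , edge-to-image v ◅ edge-to-image g⟨ v ⟩ ◅ ε
                         , fixed-point-free v ∘ sym , ggv≢v ∘ sym , fixed-point-free g⟨ v ⟩ ∘ sym )

  isSachs : (G : SimpleGraph n) → (∀ i → SimpleGraph.adj G i g⟨ i ⟩ ≡ true) → IsSachs G edges
  isSachs G along-edges = record
    { spanning   = record { sym = edges-sym ; sub = sub }
    ; components = components (λ i → adjacent⇒distinct G (along-edges i) ∘ sym) }
    where
    sub : ∀ i j → edges i j ≡ true → SimpleGraph.adj G i j ≡ true
    sub i j e with edge-cases {i} {j} e
    ... | inj₁ refl = along-edges i
    ... | inj₂ refl = trans (SimpleGraph.sym G g⟨ j ⟩ j) (along-edges j)

unique-sachs⇒same-permutation-graphs :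
  ∀ {n} (G : SimpleGraph n) → HasUniqueSachs G → (g h : Permutation′ n) →
  (∀ i → SimpleGraph.adj G i (g ⟨$⟩ʳ i) ≡ true) → (∀ i → SimpleGraph.adj G i (h ⟨$⟩ʳ i) ≡ true) →
  ∀ i j → PermutationGraph.edges g i j ≡ PermutationGraph.edges h i j
unique-sachs⇒same-permutation-graphs G (_ , _ , unique) g h g-adj h-adj i j =
  trans (unique (edges g) (isSachs g G g-adj) i j) (sym (unique (edges h) (isSachs h G h-adj) i j))
  where open PermutationGraph using (edges; isSachs)

unique-sachs⇒agrees-with-involution :
  ∀ {n} (G : SimpleGraph n) → HasUniqueSachs G → (g π : Permutation′ n) →
  (∀ i → SimpleGraph.adj G i (g ⟨$⟩ʳ i) ≡ true) → (∀ i → SimpleGraph.adj G i (π ⟨$⟩ʳ i) ≡ true) →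
  (∀ i → π ⟨$⟩ʳ (π ⟨$⟩ʳ i) ≡ i) → g Perm.≈ π
unique-sachs⇒agrees-with-involution G unique-sachs g π g-adj π-adj involutive i
  with PermutationGraph.edge-cases π
         (trans (sym (unique-sachs⇒same-permutation-graphs G unique-sachs g π g-adj π-adj i (g ⟨$⟩ʳ i)))
                (PermutationGraph.edge-to-image g i))
... | inj₁ gi≡πi = gi≡πi
... | inj₂ i≡πgi = trans (sym (involutive (g ⟨$⟩ʳ i))) (cong (π ⟨$⟩ʳ_) (sym i≡πgi))

isNegative : Sign → Bool
isNegative Sign.- = true
isNegative Sign.+ = false

∏-signℤ : ∀ {n} (t : Fin n → Sign) → ∏ (λ i → signℤ (t i)) ≡ -1ℤ ^ sum (λ i → [ isNegative (t i) ])
∏-signℤ {ℕ.zero}  t = refl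
∏-signℤ {ℕ.suc n} t with t zero
... | Sign.- = cong (ℤ._*_ -1ℤ) (∏-signℤ (t ∘ suc))
... | Sign.+ = trans (ℤP.*-identityˡ _) (∏-signℤ (t ∘ suc))

-1ℤ^even : ∀ k → -1ℤ ^ (2 ℕ.* k) ≡ 1ℤ
-1ℤ^even k = trans (sym (ℤP.^-*-assoc -1ℤ 2 k)) (ℤP.^-zeroˡ k)

module FixedPointFreeInvolution {n} (π : Permutation′ n)
  (involutive : ∀ i → π ⟨$⟩ʳ (π ⟨$⟩ʳ i) ≡ i) (fixed-point-free : ∀ i → ¬ π ⟨$⟩ʳ i ≡ i) where

  private
    π⟨_⟩ : Fin n → Fin n
    π⟨ i ⟩ = π ⟨$⟩ʳ i

    ∑₂ : (Fin n × Fin n → ℕ) → ℕ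
    ∑₂ F = sum λ i → sum λ j → F (i , j)

    ∑₂-cong : ∀ {F G} → (∀ x → F x ≡ G x) → ∑₂ F ≡ ∑₂ G
    ∑₂-cong F≗G = sum-cong-≗ (λ i → sum-cong-≗ (λ j → F≗G (i , j)))

    ∑₂-distrib-+ : ∀ F G → ∑₂ (λ x → F x ℕ.+ G x) ≡ ∑₂ F ℕ.+ ∑₂ G
    ∑₂-distrib-+ F G = trans (sum-cong-≗ (λ i → ∑-distrib-+ (λ j → F (i , j)) (λ j → G (i , j))))
                             (∑-distrib-+ (λ i → sum (λ j → F (i , j))) (λ i → sum (λ j → G (i , j))))

    transpose : Fin n × Fin n → Fin n × Fin n
    transpose (i , j) = π⟨ j ⟩ , π⟨ i ⟩

    ∑₂-transpose : ∀ F → ∑₂ (λ x → F (transpose x)) ≡ ∑₂ F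
    ∑₂-transpose F = begin
      sum (λ i → sum (λ j → F (π⟨ j ⟩ , π⟨ i ⟩)))  ≡⟨ sum-cong-≗ (λ i → sym (∑-permute (λ j → F (j , π⟨ i ⟩)) π)) ⟩
      sum (λ i → sum (λ j → F (j , π⟨ i ⟩)))       ≡⟨ ∑-comm (λ i j → F (j , π⟨ i ⟩)) ⟩
      sum (λ j → sum (λ i → F (j , π⟨ i ⟩)))       ≡⟨ sum-cong-≗ (λ j → sym (∑-permute (λ i → F (j , i)) π)) ⟩
      ∑₂ F                                          ∎
      where open ≡-Reasoning

    module Points = InvolutionPairing sum sum-cong-≗ ∑-distrib-+ π⟨_⟩ (λ f → sym (∑-permute f π))
    module Pairs  = InvolutionPairing ∑₂ ∑₂-cong ∑₂-distrib-+ transpose ∑₂-transpose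

    inverted : Fin n × Fin n → Bool
    inverted (i , j) = i <ᵇ j ∧ π⟨ j ⟩ <ᵇ π⟨ i ⟩

    matched : Fin n × Fin n → Bool
    matched (i , j) = j == π⟨ i ⟩

    matched-if : ∀ {i j} → i ≡ π⟨ j ⟩ → matched (i , j) ≡ true
    matched-if {j = j} refl = trans (cong (j ==_) (involutive j)) (==-refl j)

  -- The inversions (i, π i) are the 2-cycles with i < π i; the others are paired off by transpose.
  inversions-parity : Σ ℕ λ k → inversions π ≡ sum (λ i → [ i <ᵇ π⟨ i ⟩ ]) ℕ.+ 2 ℕ.* k
  inversions-parity = ∑₂ (λ x → [ crosses x ∧ unmatched-inverted x ]) , (begin
    inversions π                                                      ≡⟨ ∑₂-cong (λ x → indicator-split (inverted x) (matched x)) ⟩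
    ∑₂ (λ x → [ matched x ∧ inverted x ] ℕ.+ [ not (matched x) ∧ inverted x ])
      ≡⟨ ∑₂-distrib-+ (λ x → [ matched x ∧ inverted x ]) (λ x → [ not (matched x) ∧ inverted x ]) ⟩
    ∑₂ (λ x → [ matched x ∧ inverted x ]) ℕ.+ ∑₂ (λ x → [ not (matched x) ∧ inverted x ])
      ≡⟨ cong₂ ℕ._+_ (sum-cong-≗ two-cycle) (Pairs.count-double unmatched-inverted crosses unmatched∘transpose crosses∘transpose) ⟩
    sum (λ i → [ i <ᵇ π⟨ i ⟩ ]) ℕ.+ 2 ℕ.* ∑₂ (λ x → [ crosses x ∧ unmatched-inverted x ]) ∎)
    where
    open ≡-Reasoning
    unmatched-inverted crosses : Fin n × Fin n → Bool
    unmatched-inverted x = not (matched x) ∧ inverted x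
    crosses (i , j) = i <ᵇ π⟨ j ⟩
    two-cycle : ∀ i → sum (λ j → [ matched (i , j) ∧ inverted (i , j) ]) ≡ [ i <ᵇ π⟨ i ⟩ ]
    two-cycle i = trans (sum-select (==-refl π⟨ i ⟩) (λ _ → ==⇒≡) (λ j → inverted (i , j)))
                        (cong [_] (trans (cong (λ k → i <ᵇ π⟨ i ⟩ ∧ k <ᵇ π⟨ i ⟩) (involutive i)) (∧-idem _)))
    unmatched∘transpose : ∀ x → unmatched-inverted (transpose x) ≡ unmatched-inverted x
    unmatched∘transpose (i , j) rewrite involutive i | involutive j =
      cong₂ _∧_ (cong not (==-sym π⟨ i ⟩ j)) (∧-comm (π⟨ j ⟩ <ᵇ π⟨ i ⟩) (i <ᵇ j))
    crosses∘transpose : ∀ x → unmatched-inverted x ≡ true → crosses (transpose x) ≡ not (crosses x)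
    crosses∘transpose (i , j) h = trans (cong (π⟨ j ⟩ <ᵇ_) (involutive i)) (<ᵇ-flip i≢πj)
      where
      i≢πj : ¬ i ≡ π⟨ j ⟩
      i≢πj i≡πj with () ← trans (sym h) (cong (λ b → not b ∧ inverted (i , j)) (matched-if i≡πj))

  -1^inversions : -1ℤ ^ inversions π ≡ -1ℤ ^ sum (λ i → [ i <ᵇ π⟨ i ⟩ ])
  -1^inversions with inversions-parity
  ... | k , eq = begin
    -1ℤ ^ inversions π                                    ≡⟨ cong (-1ℤ ^_) eq ⟩
    -1ℤ ^ (sum (λ i → [ i <ᵇ π⟨ i ⟩ ]) ℕ.+ 2 ℕ.* k)      ≡⟨ ℤP.^-distribˡ-+-* -1ℤ (sum (λ i → [ i <ᵇ π⟨ i ⟩ ])) (2 ℕ.* k) ⟩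
    -1ℤ ^ sum (λ i → [ i <ᵇ π⟨ i ⟩ ]) ℤ.* -1ℤ ^ (2 ℕ.* k) ≡⟨ cong (ℤ._*_ (-1ℤ ^ sum (λ i → [ i <ᵇ π⟨ i ⟩ ]))) (-1ℤ^even k) ⟩
    -1ℤ ^ sum (λ i → [ i <ᵇ π⟨ i ⟩ ]) ℤ.* 1ℤ              ≡⟨ ℤP.*-identityʳ _ ⟩
    -1ℤ ^ sum (λ i → [ i <ᵇ π⟨ i ⟩ ])                     ∎
    where open ≡-Reasoning

  -- Each edge {i, π i} contributes its sign twice.
  ∏-symmetric-signs : (s : Fin n → Fin n → Sign) → (∀ i j → s i j ≡ s j i) → ∏ (λ i → signℤ (s i π⟨ i ⟩)) ≡ 1ℤ
  ∏-symmetric-signs s s-sym = begin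
    ∏ (λ i → signℤ (s i π⟨ i ⟩))                 ≡⟨ ∏-signℤ (λ i → s i π⟨ i ⟩) ⟩
    -1ℤ ^ sum (λ i → [ negative i ])             ≡⟨ cong (-1ℤ ^_) (Points.count-double negative below negative∘π below∘π) ⟩
    -1ℤ ^ (2 ℕ.* sum (λ i → [ below i ∧ negative i ])) ≡⟨ -1ℤ^even (sum (λ i → [ below i ∧ negative i ])) ⟩
    1ℤ                                           ∎
    where
    open ≡-Reasoning
    negative below : Fin n → Bool
    negative i = isNegative (s i π⟨ i ⟩)
    below i = i <ᵇ π⟨ i ⟩
    negative∘π : ∀ i → negative π⟨ i ⟩ ≡ negative i
    negative∘π i = cong isNegative (trans (cong (s π⟨ i ⟩) (involutive i)) (s-sym π⟨ i ⟩ i))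
    below∘π : ∀ i → negative i ≡ true → below π⟨ i ⟩ ≡ not (below i)
    below∘π i _ = trans (cong (π⟨ i ⟩ <ᵇ_) (involutive i)) (<ᵇ-flip (fixed-point-free i ∘ sym))

signℤ≢0 : ∀ s → ¬ signℤ s ≡ 0ℤ
signℤ≢0 Sign.- ()
signℤ≢0 Sign.+ ()

module _ {n} (Gσ : SignedGraph n) where
  open SignedGraph Gσ using (adj; σ)

  adjMatrix-edge : ∀ {i j} → adj i j ≡ true → adjMatrix Gσ i j ≡ signℤ (σ i j)
  adjMatrix-edge {i} {j} = cong (λ b → if b then signℤ (σ i j) else 0ℤ)

  adjacent⇒supported : (g : Permutation′ n) → (∀ i → adj i (g ⟨$⟩ʳ i) ≡ true) → Supported (adjMatrix Gσ) g
  adjacent⇒supported g along-edges i = signℤ≢0 (σ i (g ⟨$⟩ʳ i)) ∘ trans (sym (adjMatrix-edge (along-edges i)))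

  supported⇒adjacent : (g : Permutation′ n) → Supported (adjMatrix Gσ) g → ∀ i → adj i (g ⟨$⟩ʳ i) ≡ true
  supported⇒adjacent g supp i with adj i (g ⟨$⟩ʳ i) in e
  ... | true  = refl
  ... | false = ⊥-elim (supp i (cong (λ b → if b then signℤ (σ i (g ⟨$⟩ʳ i)) else 0ℤ) e))

module PerfectMatching {n} {G : SimpleGraph n} {M : EdgeSet n} (pm : IsPerfectMatching G M) where
  open IsPerfectMatching pm using (spanning; deg1)

  private
    unique-partner : ∀ v → Σ (Fin n) λ w → M v w ≡ true × (∀ u → M v u ≡ true → u ≡ w)
    unique-partner v = indicator-sum≡1⇒unique (M v) (trans (sym (∑ℕ≡sum (λ w → [ M v w ]))) (deg1 v))

  partner : Fin n → Fin n
  partner v = proj₁ (unique-partner v)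

  partner-matched : ∀ v → M v (partner v) ≡ true
  partner-matched v = proj₁ (proj₂ (unique-partner v))

  partner-unique : ∀ v u → M v u ≡ true → u ≡ partner v
  partner-unique v = proj₂ (proj₂ (unique-partner v))

  partner-involutive : ∀ v → partner (partner v) ≡ v
  partner-involutive v =
    sym (partner-unique (partner v) v (trans (IsSpanningSubgraph.sym spanning (partner v) v) (partner-matched v)))

  partner-adjacent : ∀ v → SimpleGraph.adj G v (partner v) ≡ true
  partner-adjacent v = IsSpanningSubgraph.sub spanning v (partner v) (partner-matched v)

  partner-fixed-point-free : ∀ v → ¬ partner v ≡ v
  partner-fixed-point-free v = adjacent⇒distinct G (partner-adjacent v) ∘ sym

  partnerPermutation : Permutation′ n
  partnerPermutation = Perm.permutation partner partner partner-involutive partner-involutive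

  edgeCount-matching : edgeCount M ≡ sum (λ i → [ i <ᵇ partner i ])
  edgeCount-matching = trans (∑ℕ≡sum (λ i → ∑ℕ (λ j → [ M i j ∧ i <ᵇ j ]))) (sum-cong-≗ λ i →
    trans (∑ℕ≡sum (λ j → [ M i j ∧ i <ᵇ j ])) (sum-select (partner-matched i) (partner-unique i) (i <ᵇ_)))

corollary2p4 : (n : ℕ) (Gσ : SignedGraph n) → HasUniqueSachs (SignedGraph.graph Gσ) → (M : EdgeSet n) → IsPerfectMatching (SignedGraph.graph Gσ) M → det (adjMatrix Gσ) ≡ -1ℤ ^ edgeCount M
corollary2p4 n Gσ unique-sachs M pm = begin
  det A                                                     ≡⟨ det-unique-support A π supported unique-support ⟩
  -1ℤ ^ inversions π ℤ.* ∏ (λ i → A i (partner i))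
    ≡⟨ cong₂ ℤ._*_ -1^inversions (trans (ℤ∏.sum-cong-≗ (λ i → adjMatrix-edge Gσ (partner-adjacent i))) (∏-symmetric-signs σ σ-sym)) ⟩
  -1ℤ ^ sum (λ i → [ i <ᵇ partner i ]) ℤ.* 1ℤ              ≡⟨ ℤP.*-identityʳ _ ⟩
  -1ℤ ^ sum (λ i → [ i <ᵇ partner i ])                      ≡⟨ cong (-1ℤ ^_) edgeCount-matching ⟨
  -1ℤ ^ edgeCount M                                         ∎
  where
  open ≡-Reasoning
  open SignedGraph Gσ using (graph; σ; σ-sym)
  open PerfectMatching pm
  A = adjMatrix Gσ
  π = partnerPermutation
  open FixedPointFreeInvolution π partner-involutive partner-fixed-point-free
  supported : Supported A π
  supported = adjacent⇒supported Gσ π partner-adjacent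
  unique-support : ∀ g → Supported A g → g Perm.≈ π
  unique-support g supp-g = unique-sachs⇒agrees-with-involution graph unique-sachs g π
    (supported⇒adjacent Gσ g supp-g) partner-adjacent partner-involutive
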